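{- For every integer $c\ge 1$, the words $u=(10)^{\langle 4c-2\rangle}$ and $v=(0110)^{\langle 4c-2\rangle}$ satisfy $\mathrm{d}(u,v)=c$ and $m_{\mathsf{LCS}}(u,v)=\binom{2c}{c}$.
   Context: For a nonempty word $w$ and natural number $m$, $w^{\langle m\rangle}$ is the prefix of length $m$ of the infinite word $www\cdots$ (e.g. $(01)^{\langle 7\rangle}=0101010$). For binary words $u,v$ of the same length $n$, $\mathrm{LCS}(u,v)$ is the maximum length of a common subsequence, $\mathrm{d}(u,v)=n-\mathrm{LCS}(u,v)$, and $m_{\mathsf{LCS}}(u,v)$ is the number of distinct common subsequences of $u,v$ of length $\mathrm{LCS}(u,v)$. -}

module Defs where

open import Data.Bool using (Bool; true; false)
open import Data.Nat using (ℕ; _≤_; _∸_)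
open import Data.List using (List; []; _∷_; length; take; concat; replicate)
open import Data.List.Relation.Binary.Sublist.Propositional using (_⊆_)
open import Data.List.Relation.Unary.Unique.Propositional using (Unique)
open import Data.List.Membership.Propositional using (_∈_)
open import Data.Product using (_×_; ∃-syntax)
open import Function.Bundles using (_⇔_)

-- Binary words: letter 0 is false, letter 1 is true.
Word : Set
Word = List Bool

-- w ^⟨ m ⟩ : prefix of length m of the infinite word w w w ...
-- (for nonempty w, m copies of w have length ≥ m)
_^⟨_⟩ : Word → ℕ → Word
w ^⟨ m ⟩ = take m (concat (replicate m w))

CommonSubseq : Word → Word → Word → Set
CommonSubseq s u v = (s ⊆ u) × (s ⊆ v)

IsLCS : Word → Word → ℕ → Set
IsLCS u v k =
  (∃[ s ] (CommonSubseq s u v × length s ≡ k)) ×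
  (∀ s → CommonSubseq s u v → length s ≤ k)
  where open import Relation.Binary.PropositionalEquality using (_≡_)

HasCard : (Word → Set) → ℕ → Set
HasCard P N = ∃[ l ] (Unique l × (∀ w → (w ∈ l) ⇔ P w) × length l ≡ N)
  where open import Relation.Binary.PropositionalEquality using (_≡_)

IsDist : Word → Word → ℕ → Set
IsDist u v δ = ∃[ k ] (IsLCS u v k × length u ∸ k ≡ δ)
  where open import Relation.Binary.PropositionalEquality using (_≡_)

IsMLCS : Word → Word → ℕ → Set
IsMLCS u v m = ∃[ k ] (IsLCS u v k × HasCard (λ s → CommonSubseq s u v × length s ≡ k) m)
  where open import Relation.Binary.PropositionalEquality using (_≡_)

module Submission where

-- Common subsequences of a given length are enumerated by choosing the first letter and jumping to
-- its first occurrence in both words; the resulting list is complete and duplicate-free.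
-- Take u = (ab)^⟨2k+j⟩ and v = (baab)^⟨2j+2⟩.  Along any common embedding, the potential 2|x| + |y|
-- of the remaining suffixes x of u and y of v drops, up to an offset of at most 2, by 4 per matched
-- letter, so LCS(u,v) ≤ k + j.  Split the common subsequences of length k + j by their first letter:
-- the branch of u's first letter is the instance (j-1, k) with the letters swapped; in the other
-- branch both remainders start with u's first letter, which the LCS bound forces to come next,
-- leaving the instance (j-1, k-1).  So their number N(j,k) obeys Pascal's rule, and N(0,k) = C(2,k)
-- gives N(j,k) = C(j+2,k).  The theorem is the case j = 2c - 2, k = c.

open import Defs
open import Data.Bool using (Bool; true; false; not)
open import Data.Bool.Properties using (not-¬)
open import Data.Nat using (ℕ; zero; suc; _≤_; _<_; _+_; _*_; _∸_; z≤n; s≤s; s≤s⁻¹)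
open import Data.Nat.Properties
  using (suc-injective; +-comm; +-identityʳ; +-suc; +-monoʳ-≤; *-suc; *-cancelˡ-<; m+n∸m≡n;
         ≤-refl; ≤-reflexive; ≤-trans; <-irrefl; m≤m+n; m≤n+m; n≤1+n; module ≤-Reasoning)
open import Data.Nat.Combinatorics using (_C_; nCk+nC[k+1]≡[n+1]C[k+1])
open import Data.Nat.Combinatorics.Specification using (k>n⇒nCk≡0)
open import Data.Nat.Tactic.RingSolver using (solve)
open import Data.List using (List; []; _∷_; length; map; _++_; take; concat; replicate)
open import Data.List.Properties using (∷-injectiveʳ; length-++; length-map)
open import Data.List.Membership.Propositional using (_∈_)
open import Data.List.Membership.Propositional.Properties using (∈-++⁻; ∈-++⁺ˡ; ∈-++⁺ʳ; ∈-map⁻; ∈-map⁺)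
open import Data.List.Relation.Binary.Sublist.Propositional using (_⊆_; []; _∷_; _∷ʳ_)
open import Data.List.Relation.Binary.Sublist.Propositional.Properties
  using (∷ˡ⁻; ∷ʳ⁻; []⊆-universal; length-mono-≤)
open import Data.List.Relation.Unary.Any using (here)
open import Data.List.Relation.Unary.All using ([])
open import Data.List.Relation.Unary.AllPairs using ([]; _∷_)
open import Data.List.Relation.Unary.Unique.Propositional using (Unique)
import Data.List.Relation.Unary.Unique.Propositional.Properties as Unique
open import Data.Maybe using (Maybe; just; nothing)
open import Data.Product using (_×_; _,_; ∃-syntax)
open import Data.Sum using (inj₁; inj₂)
open import Data.Empty using (⊥)
open import Function.Bundles using (mk⇔)
open import Relation.Binary.PropositionalEquality
  using (_≡_; _≢_; refl; sym; trans; cong; cong₂; subst; subst₂; ≢-sym; module ≡-Reasoning)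
open import Relation.Nullary using (contradiction)

afterFirst : Bool → Word → Maybe Word
afterFirst a     []          = nothing
afterFirst false (false ∷ w) = just w
afterFirst true  (true ∷ w)  = just w
afterFirst false (true ∷ w)  = afterFirst false w
afterFirst true  (false ∷ w) = afterFirst true w

afterFirst-here : ∀ a w → afterFirst a (a ∷ w) ≡ just w
afterFirst-here false w = refl
afterFirst-here true  w = refl

afterFirst-there : ∀ {a c} → a ≢ c → ∀ w → afterFirst a (c ∷ w) ≡ afterFirst a w
afterFirst-there {false} {false} a≢c w = contradiction refl a≢c
afterFirst-there {false} {true}  a≢c w = refl
afterFirst-there {true}  {false} a≢c w = refl
afterFirst-there {true}  {true}  a≢c w = contradiction refl a≢c

afterFirst-sound : ∀ a w {w′ s} → afterFirst a w ≡ just w′ → s ⊆ w′ → a ∷ s ⊆ w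
afterFirst-sound false (false ∷ w) refl s⊆w′ = refl ∷ s⊆w′
afterFirst-sound true  (true ∷ w)  refl s⊆w′ = refl ∷ s⊆w′
afterFirst-sound false (true ∷ w)  eq   s⊆w′ = true ∷ʳ afterFirst-sound false w eq s⊆w′
afterFirst-sound true  (false ∷ w) eq   s⊆w′ = false ∷ʳ afterFirst-sound true w eq s⊆w′

afterFirst-complete : ∀ a w {s} → a ∷ s ⊆ w → ∃[ w′ ] (afterFirst a w ≡ just w′ × s ⊆ w′)
afterFirst-complete a     (.a ∷ w)   (refl ∷ s⊆w) = w , afterFirst-here a w , s⊆w
afterFirst-complete false (false ∷ w) (_ ∷ʳ as⊆w) = w , refl , ∷ˡ⁻ as⊆w
afterFirst-complete true  (true ∷ w)  (_ ∷ʳ as⊆w) = w , refl , ∷ˡ⁻ as⊆w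
afterFirst-complete false (true ∷ w)  (_ ∷ʳ as⊆w) = afterFirst-complete false w as⊆w
afterFirst-complete true  (false ∷ w) (_ ∷ʳ as⊆w) = afterFirst-complete true w as⊆w

commonSubseqs : ℕ → Word → Word → List Word
startingWith : Bool → ℕ → Word → Word → List Word
extend : Bool → ℕ → Maybe Word → Maybe Word → List Word

commonSubseqs zero    x y = [] ∷ []
commonSubseqs (suc ℓ) x y = startingWith false ℓ x y ++ startingWith true ℓ x y

startingWith a ℓ x y = extend a ℓ (afterFirst a x) (afterFirst a y)

extend a ℓ (just x′) (just y′) = map (a ∷_) (commonSubseqs ℓ x′ y′)
extend a ℓ _         _         = []

commonSubseqs-sound : ∀ ℓ x y {s} → s ∈ commonSubseqs ℓ x y → CommonSubseq s x y × length s ≡ ℓ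
startingWith-sound : ∀ a ℓ x y {s} → s ∈ startingWith a ℓ x y →
  ∃[ t ] (s ≡ a ∷ t × CommonSubseq s x y × length t ≡ ℓ)

commonSubseqs-sound zero    x y (here refl) = ([]⊆-universal x , []⊆-universal y) , refl
commonSubseqs-sound (suc ℓ) x y s∈ with ∈-++⁻ (startingWith false ℓ x y) s∈
... | inj₁ s∈₀ with startingWith-sound false ℓ x y s∈₀
...   | _ , refl , common , len = common , cong suc len
commonSubseqs-sound (suc ℓ) x y s∈ | inj₂ s∈₁ with startingWith-sound true ℓ x y s∈₁
...   | _ , refl , common , len = common , cong suc len

startingWith-sound a ℓ x y s∈ with afterFirst a x in ex | afterFirst a y in ey
... | just x′ | just y′ with ∈-map⁻ (a ∷_) s∈
...   | t , t∈ , refl with commonSubseqs-sound ℓ x′ y′ t∈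
...     | (t⊆x′ , t⊆y′) , len =
  t , refl , (afterFirst-sound a x ex t⊆x′ , afterFirst-sound a y ey t⊆y′) , len

commonSubseqs-complete : ∀ ℓ x y {s} → CommonSubseq s x y → length s ≡ ℓ → s ∈ commonSubseqs ℓ x y
startingWith-complete : ∀ a ℓ x y {t} → CommonSubseq (a ∷ t) x y → length t ≡ ℓ →
  a ∷ t ∈ startingWith a ℓ x y

commonSubseqs-complete zero    x y {[]}        _      _   = here refl
commonSubseqs-complete (suc ℓ) x y {false ∷ t} common len =
  ∈-++⁺ˡ (startingWith-complete false ℓ x y common (suc-injective len))
commonSubseqs-complete (suc ℓ) x y {true ∷ t}  common len =
  ∈-++⁺ʳ (startingWith false ℓ x y) (startingWith-complete true ℓ x y common (suc-injective len))

startingWith-complete a ℓ x y (at⊆x , at⊆y) len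
  with afterFirst-complete a x at⊆x | afterFirst-complete a y at⊆y
... | x′ , ex , t⊆x′ | y′ , ey , t⊆y′ rewrite ex | ey =
  ∈-map⁺ (a ∷_) (commonSubseqs-complete ℓ x′ y′ (t⊆x′ , t⊆y′) len)

commonSubseqs-unique : ∀ ℓ x y → Unique (commonSubseqs ℓ x y)
startingWith-unique : ∀ a ℓ x y → Unique (startingWith a ℓ x y)

commonSubseqs-unique zero    x y = [] ∷ []
commonSubseqs-unique (suc ℓ) x y =
  Unique.++⁺ (startingWith-unique false ℓ x y) (startingWith-unique true ℓ x y) disjoint
  where
  disjoint : ∀ {s} → s ∈ startingWith false ℓ x y × s ∈ startingWith true ℓ x y → ⊥
  disjoint (s∈₀ , s∈₁) with startingWith-sound false ℓ x y s∈₀ | startingWith-sound true ℓ x y s∈₁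
  ... | _ , refl , _ | _ , () , _

startingWith-unique a ℓ x y with afterFirst a x | afterFirst a y
... | just x′ | just y′  = Unique.map⁺ ∷-injectiveʳ (commonSubseqs-unique ℓ x′ y′)
... | just _  | nothing = []
... | nothing | _       = []

commonSubseqs-hasCard : ∀ ℓ x y →
  HasCard (λ s → CommonSubseq s x y × length s ≡ ℓ) (length (commonSubseqs ℓ x y))
commonSubseqs-hasCard ℓ x y =
  commonSubseqs ℓ x y , commonSubseqs-unique ℓ x y ,
  (λ s → mk⇔ (commonSubseqs-sound ℓ x y) λ (common , len) → commonSubseqs-complete ℓ x y common len) ,
  refl

length-commonSubseqs-suc : ∀ {a b} → a ≢ b → ∀ ℓ x y →
  length (commonSubseqs (suc ℓ) x y) ≡ length (startingWith a ℓ x y) + length (startingWith b ℓ x y)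
length-commonSubseqs-suc {false} {true}  _   ℓ x y = length-++ (startingWith false ℓ x y)
length-commonSubseqs-suc {true}  {false} _   ℓ x y =
  trans (length-++ (startingWith false ℓ x y))
        (+-comm (length (startingWith false ℓ x y)) (length (startingWith true ℓ x y)))
length-commonSubseqs-suc {false} {false} a≢b = contradiction refl a≢b
length-commonSubseqs-suc {true}  {true}  a≢b = contradiction refl a≢b

length-startingWith : ∀ a ℓ x y {x′ y′} → afterFirst a x ≡ just x′ → afterFirst a y ≡ just y′ →
  length (startingWith a ℓ x y) ≡ length (commonSubseqs ℓ x′ y′)
length-startingWith a ℓ x y {x′} {y′} ex ey rewrite ex | ey =
  length-map (a ∷_) (commonSubseqs ℓ x′ y′)

no-member⇒length≡0 : {L : List Word} → (∀ {s} → s ∈ L → ⊥) → length L ≡ 0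
no-member⇒length≡0 {[]}    _    = refl
no-member⇒length≡0 {_ ∷ _} ∉L = contradiction (here refl) ∉L

length-commonSubseqs-≡0 : ∀ ℓ x y → (∀ s → CommonSubseq s x y → length s < ℓ) →
  length (commonSubseqs ℓ x y) ≡ 0
length-commonSubseqs-≡0 ℓ x y short = no-member⇒length≡0 λ s∈ →
  let common , len = commonSubseqs-sound ℓ x y s∈ in <-irrefl len (short _ common)

length-startingWith-≡0 : ∀ a ℓ x y → (∀ t → CommonSubseq (a ∷ t) x y → length t < ℓ) →
  length (startingWith a ℓ x y) ≡ 0
length-startingWith-≡0 a ℓ x y short = no-member⇒length≡0 λ s∈ →
  let t , s≡at , common , len = startingWith-sound a ℓ x y s∈
  in <-irrefl len (short t (subst (λ s → CommonSubseq s x y) s≡at common))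

length-commonSubseqs-cons : ∀ a ℓ x y → (∀ s → CommonSubseq s x y → length s ≤ ℓ) →
  length (commonSubseqs (suc ℓ) (a ∷ x) (a ∷ y)) ≡ length (commonSubseqs ℓ x y)
length-commonSubseqs-cons a ℓ x y lcs≤ℓ = begin
  length (commonSubseqs (suc ℓ) (a ∷ x) (a ∷ y))
    ≡⟨ length-commonSubseqs-suc a≢¬a ℓ (a ∷ x) (a ∷ y) ⟩
  length (startingWith a ℓ (a ∷ x) (a ∷ y)) + length (startingWith (not a) ℓ (a ∷ x) (a ∷ y))
    ≡⟨ cong₂ _+_ (length-startingWith a ℓ (a ∷ x) (a ∷ y) (afterFirst-here a x) (afterFirst-here a y))
                 (length-startingWith-≡0 (not a) ℓ (a ∷ x) (a ∷ y) λ t (p , q) →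
                    lcs≤ℓ (not a ∷ t) (∷ʳ⁻ (≢-sym a≢¬a) p , ∷ʳ⁻ (≢-sym a≢¬a) q)) ⟩
  length (commonSubseqs ℓ x y) + 0
    ≡⟨ +-identityʳ _ ⟩
  length (commonSubseqs ℓ x y) ∎
  where
  open ≡-Reasoning
  a≢¬a : a ≢ not a
  a≢¬a = not-¬ refl

alternating : Bool → Bool → ℕ → Word
alternating a b zero    = []
alternating a b (suc n) = a ∷ alternating b a n

-- paired a b true m and paired a b false m are the prefixes of length m of aabbaabb… and abbaabba….
paired : Bool → Bool → Bool → ℕ → Word
paired a b r     zero    = []
paired a b true  (suc m) = a ∷ paired a b false m
paired a b false (suc m) = a ∷ paired b a true m

length-alternating : ∀ a b n → length (alternating a b n) ≡ n
length-alternating a b zero    = refl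
length-alternating a b (suc n) = cong suc (length-alternating b a n)

-- Matching the common first letter of alternating a b and paired a b r leaves first letters that
-- differ (r = true) or agree in front of a doubled letter (r = false); offset r pays for this.
offset : Bool → ℕ
offset true  = 1
offset false = 2

offset≤2 : ∀ r → offset r ≤ 2
offset≤2 true  = s≤s z≤n
offset≤2 false = ≤-refl

m+d≡n⇒m≤n : ∀ {m n} d → m + d ≡ n → m ≤ n
m+d≡n⇒m≤n {m} d refl = m≤m+n m d

4*-mono-suc : ∀ {k e} → 4 * k ≤ e → 4 * suc k ≤ 4 + e
4*-mono-suc {k} {e} 4k≤e = subst (_≤ 4 + e) (sym (*-suc 4 k)) (+-monoʳ-≤ 4 4k≤e)

lcs-bound-aligned : ∀ {a b} → a ≢ b → ∀ n m r {s} → s ⊆ alternating a b n → s ⊆ paired a b r m →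
  4 * length s ≤ 2 * n + m + offset r
lcs-bound-opposite : ∀ {a b} → a ≢ b → ∀ n m r {s} → s ⊆ alternating a b n → s ⊆ paired b a r m →
  4 * length s ≤ 2 * n + m

lcs-bound-aligned a≢b n       m       r {[]}    _ _  = z≤n
lcs-bound-aligned a≢b zero    m       r {_ ∷ _} () _
lcs-bound-aligned a≢b (suc n) zero    r {_ ∷ _} _ ()
lcs-bound-aligned a≢b (suc n) (suc m) r {s} (_ ∷ʳ σ) τ = begin
  4 * length s                 ≤⟨ lcs-bound-opposite (≢-sym a≢b) n (suc m) r σ τ ⟩
  2 * n + suc m                ≤⟨ m+d≡n⇒m≤n 2 (solve (n ∷ m ∷ [])) ⟩
  2 * suc n + suc m            ≤⟨ m≤m+n _ (offset r) ⟩
  2 * suc n + suc m + offset r ∎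
  where open ≤-Reasoning
lcs-bound-aligned a≢b (suc n) (suc m) true (refl ∷ σ) (_ ∷ʳ τ) =
  ≤-trans (lcs-bound-aligned a≢b (suc n) m false (refl ∷ σ) τ) (≤-reflexive (solve (n ∷ m ∷ [])))
lcs-bound-aligned a≢b (suc n) (suc m) false (refl ∷ σ) (_ ∷ʳ τ) =
  ≤-trans (lcs-bound-opposite a≢b (suc n) m true (refl ∷ σ) τ) (m+d≡n⇒m≤n 3 (solve (n ∷ m ∷ [])))
lcs-bound-aligned a≢b (suc n) (suc m) true (refl ∷ σ) (refl ∷ τ) =
  ≤-trans (4*-mono-suc (lcs-bound-opposite (≢-sym a≢b) n m false σ τ))
          (≤-reflexive (solve (n ∷ m ∷ [])))
lcs-bound-aligned a≢b (suc n) (suc m) false (refl ∷ σ) (refl ∷ τ) =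
  ≤-trans (4*-mono-suc (lcs-bound-aligned (≢-sym a≢b) n m true σ τ))
          (≤-reflexive (solve (n ∷ m ∷ [])))

lcs-bound-opposite a≢b n       m       r {[]}    _ _  = z≤n
lcs-bound-opposite a≢b zero    m       r {_ ∷ _} () _
lcs-bound-opposite a≢b (suc n) zero    r {_ ∷ _} _ ()
lcs-bound-opposite a≢b (suc n) (suc m) r {s} (_ ∷ʳ σ) τ = begin
  4 * length s               ≤⟨ lcs-bound-aligned (≢-sym a≢b) n (suc m) r σ τ ⟩
  2 * n + suc m + offset r   ≤⟨ +-monoʳ-≤ (2 * n + suc m) (offset≤2 r) ⟩
  2 * n + suc m + 2          ≡⟨ solve (n ∷ m ∷ []) ⟩
  2 * suc n + suc m          ∎
  where open ≤-Reasoning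
lcs-bound-opposite a≢b (suc n) (suc m) true (x≡a ∷ σ) (_ ∷ʳ τ) =
  ≤-trans (lcs-bound-opposite a≢b (suc n) m false (x≡a ∷ σ) τ) (m+d≡n⇒m≤n 1 (solve (n ∷ m ∷ [])))
lcs-bound-opposite a≢b (suc n) (suc m) false (x≡a ∷ σ) (_ ∷ʳ τ) =
  ≤-trans (lcs-bound-aligned a≢b (suc n) m true (x≡a ∷ σ) τ) (≤-reflexive (solve (n ∷ m ∷ [])))
lcs-bound-opposite a≢b (suc n) (suc m) true  (refl ∷ σ) (a≡b ∷ τ) = contradiction a≡b a≢b
lcs-bound-opposite a≢b (suc n) (suc m) false (refl ∷ σ) (a≡b ∷ τ) = contradiction a≡b a≢b

family-lcs-bound : ∀ {a b} → a ≢ b → ∀ j k s →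
  CommonSubseq s (alternating a b (k + k + j)) (paired b a false (2 + (j + j))) → length s ≤ k + j
family-lcs-bound a≢b j k s (s⊆x , s⊆y) = s≤s⁻¹ (*-cancelˡ-< 4 (length s) (suc (k + j)) (begin-strict
  4 * length s                     ≤⟨ lcs-bound-opposite a≢b (k + k + j) (2 + (j + j)) false s⊆x s⊆y ⟩
  2 * (k + k + j) + (2 + (j + j))  <⟨ m+d≡n⇒m≤n 1 (solve (j ∷ k ∷ [])) ⟩
  4 * suc (k + j)                  ∎))
  where open ≤-Reasoning

countCommon : Bool → Bool → ℕ → ℕ → ℕ → ℕ
countCommon a b ℓ p q = length (commonSubseqs ℓ (alternating a b p) (paired b a false q))

countCommon-cong : ∀ a b {ℓ ℓ′ p p′ q q′} → ℓ ≡ ℓ′ → p ≡ p′ → q ≡ q′ →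
  countCommon a b ℓ p q ≡ countCommon a b ℓ′ p′ q′
countCommon-cong a b refl refl refl = refl

countCommon-pascal : ∀ {a b} → a ≢ b → ∀ ℓ p q →
  (∀ s → CommonSubseq s (alternating b a p) (paired a b false q) → length s ≤ ℓ) →
  countCommon a b (2 + ℓ) (3 + p) (2 + q) ≡ countCommon b a (suc ℓ) (2 + p) q + countCommon b a ℓ p q
countCommon-pascal {a} {b} a≢b ℓ p q lcs≤ℓ =
  trans (length-commonSubseqs-suc a≢b (suc ℓ) x y) (cong₂ _+_ via-a via-b)
  where
  x y : Word
  x = alternating a b (3 + p)
  y = paired b a false (2 + q)
  via-a : length (startingWith a (suc ℓ) x y) ≡ countCommon b a (suc ℓ) (2 + p) q
  via-a = length-startingWith a (suc ℓ) x y (afterFirst-here a _)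
            (trans (afterFirst-there a≢b _) (afterFirst-here a _))
  via-b : length (startingWith b (suc ℓ) x y) ≡ countCommon b a ℓ p q
  via-b = trans (length-startingWith b (suc ℓ) x y
                   (trans (afterFirst-there (≢-sym a≢b) _) (afterFirst-here b _)) (afterFirst-here b _))
                (length-commonSubseqs-cons a ℓ _ _ lcs≤ℓ)

countCommon-edge : ∀ {a b} → a ≢ b → ∀ ℓ q →
  countCommon a b (suc ℓ) (suc ℓ) (2 + q) ≡ countCommon b a ℓ ℓ q
countCommon-edge {a} {b} a≢b ℓ q =
  trans (length-commonSubseqs-suc a≢b ℓ x y) (trans (cong₂ _+_ via-a via-b) (+-identityʳ _))
  where
  x y : Word
  x = alternating a b (suc ℓ)
  y = paired b a false (2 + q)
  via-a : length (startingWith a ℓ x y) ≡ countCommon b a ℓ ℓ q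
  via-a = length-startingWith a ℓ x y (afterFirst-here a _)
            (trans (afterFirst-there a≢b _) (afterFirst-here a _))
  via-b : length (startingWith b ℓ x y) ≡ 0
  via-b = length-startingWith-≡0 b ℓ x y λ t (bt⊆x , _) →
    subst (suc (length t) ≤_) (length-alternating b a ℓ) (length-mono-≤ (∷ʳ⁻ (≢-sym a≢b) bt⊆x))

countCommon-family-base : ∀ {a b} → a ≢ b → ∀ k → countCommon a b (k + 0) (k + k + 0) 2 ≡ 2 C k
countCommon-family-base _ zero = refl
countCommon-family-base {a} {b} _ k@(suc (suc (suc _))) =
  trans (length-commonSubseqs-≡0 (k + 0) (alternating a b (k + k + 0)) (paired b a false 2) too-long)
        (sym (k>n⇒nCk≡0 {2} {k} (s≤s (s≤s (s≤s z≤n)))))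
  where
  too-long : ∀ s → CommonSubseq s (alternating a b (k + k + 0)) (paired b a false 2) → length s < k + 0
  too-long s (_ , s⊆y) = s≤s (≤-trans (length-mono-≤ s⊆y) (s≤s (s≤s z≤n)))
countCommon-family-base {false} {true}  _ 1 = refl
countCommon-family-base {true}  {false} _ 1 = refl
countCommon-family-base {false} {true}  _ 2 = refl
countCommon-family-base {true}  {false} _ 2 = refl
countCommon-family-base {false} {false} a≢b (suc _) = contradiction refl a≢b
countCommon-family-base {true}  {true}  a≢b (suc _) = contradiction refl a≢b

countCommon-family : ∀ {a b} → a ≢ b → ∀ j k →
  countCommon a b (k + j) (k + k + j) (2 + (j + j)) ≡ (2 + j) C k
countCommon-family a≢b zero k = countCommon-family-base a≢b k
countCommon-family {a} {b} a≢b (suc j) zero =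
  trans (cong (λ q → countCommon a b (suc j) (suc j) (2 + q)) (cong suc (+-suc j j)))
        (trans (countCommon-edge a≢b j (2 + (j + j))) (countCommon-family (≢-sym a≢b) j zero))
countCommon-family {a} {b} a≢b (suc j) (suc k) = begin
  countCommon a b (suc k + suc j) (suc k + suc k + suc j) (2 + (suc j + suc j))
    ≡⟨ countCommon-cong a b (cong suc (+-suc k j)) three+ (cong (2 +_) (cong suc (+-suc j j))) ⟩
  countCommon a b (2 + (k + j)) (3 + (k + k + j)) (2 + (2 + (j + j)))
    ≡⟨ countCommon-pascal a≢b (k + j) (k + k + j) (2 + (j + j)) (family-lcs-bound (≢-sym a≢b) j k) ⟩
  countCommon b a (suc (k + j)) (2 + (k + k + j)) (2 + (j + j))
    + countCommon b a (k + j) (k + k + j) (2 + (j + j))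
    ≡⟨ cong₂ _+_ (trans (cong (λ p → countCommon b a (suc (k + j)) p (2 + (j + j))) (sym two+))
                        (countCommon-family b≢a j (suc k)))
                 (countCommon-family b≢a j k) ⟩
  (2 + j) C suc k + (2 + j) C k
    ≡⟨ +-comm ((2 + j) C suc k) _ ⟩
  (2 + j) C k + (2 + j) C suc k
    ≡⟨ nCk+nC[k+1]≡[n+1]C[k+1] (2 + j) k ⟩
  (3 + j) C suc k ∎
  where
  open ≡-Reasoning
  b≢a : b ≢ a
  b≢a = ≢-sym a≢b
  three+ : suc k + suc k + suc j ≡ 3 + (k + k + j)
  three+ = solve (j ∷ k ∷ [])
  two+ : suc k + suc k + j ≡ 2 + (k + k + j)
  two+ = solve (j ∷ k ∷ [])

k≤n⇒0<nCk : ∀ n k → k ≤ n → 0 < n C k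
k≤n⇒0<nCk n       zero    _         = s≤s z≤n
k≤n⇒0<nCk (suc n) (suc k) (s≤s k≤n) =
  subst (0 <_) (nCk+nC[k+1]≡[n+1]C[k+1] n k) (≤-trans (k≤n⇒0<nCk n k k≤n) (m≤m+n _ _))

nonempty-member : (L : List Word) → 0 < length L → ∃[ s ] (s ∈ L)
nonempty-member (s ∷ _) _ = s , here refl

dist-mlcs-family : ∀ {a b} → a ≢ b → ∀ j k → k ≤ 2 + j →
  IsDist (alternating a b (k + k + j)) (paired b a false (2 + (j + j))) k ×
  IsMLCS (alternating a b (k + k + j)) (paired b a false (2 + (j + j))) ((2 + j) C k)
dist-mlcs-family {a} {b} a≢b j k k≤2+j = (k + j , isLCS , distance) , (k + j , isLCS , card)
  where
  x y : Word
  x = alternating a b (k + k + j)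
  y = paired b a false (2 + (j + j))
  card : HasCard (λ s → CommonSubseq s x y × length s ≡ k + j) ((2 + j) C k)
  card = subst (HasCard _) (countCommon-family a≢b j k) (commonSubseqs-hasCard (k + j) x y)
  isLCS : IsLCS x y (k + j)
  isLCS =
    let s , s∈ = nonempty-member (commonSubseqs (k + j) x y)
                   (subst (0 <_) (sym (countCommon-family a≢b j k)) (k≤n⇒0<nCk (2 + j) k k≤2+j))
    in (s , commonSubseqs-sound (k + j) x y s∈) , family-lcs-bound a≢b j k
  distance : length x ∸ (k + j) ≡ k
  distance = begin
    length x ∸ (k + j)     ≡⟨ cong (_∸ (k + j)) (length-alternating a b (k + k + j)) ⟩
    k + k + j ∸ (k + j)    ≡⟨ cong (_∸ (k + j)) (solve (j ∷ k ∷ [])) ⟩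
    k + j + k ∸ (k + j)    ≡⟨ m+n∸m≡n (k + j) k ⟩
    k                      ∎
    where open ≡-Reasoning

take-cycle-alternating : ∀ a b n M → n ≤ M →
  take n (concat (replicate M (a ∷ b ∷ []))) ≡ alternating a b n
take-cycle-alternating a b zero          M       _         = refl
take-cycle-alternating a b (suc zero)    (suc M) _         = refl
take-cycle-alternating a b (suc (suc n)) (suc M) (s≤s n<M) =
  cong (λ w → a ∷ b ∷ w) (take-cycle-alternating a b n M (≤-trans (n≤1+n n) n<M))

take-cycle-paired : ∀ a b n M → n ≤ M →
  take n (concat (replicate M (a ∷ b ∷ b ∷ a ∷ []))) ≡ paired a b false n
take-cycle-paired a b zero                      M       _          = refl
take-cycle-paired a b (suc zero)                (suc M) _          = refl
take-cycle-paired a b (suc (suc zero))          (suc M) _          = refl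
take-cycle-paired a b (suc (suc (suc zero)))    (suc M) _          = refl
take-cycle-paired a b (suc (suc (suc (suc n)))) (suc M) (s≤s 3+n≤M) =
  cong (λ w → a ∷ b ∷ b ∷ a ∷ w) (take-cycle-paired a b n M (≤-trans (m≤n+m n 3) 3+n≤M))

propositionA1 : (c : ℕ) → 1 ≤ c →
    IsDist ((true ∷ false ∷ []) ^⟨ 4 * c ∸ 2 ⟩) ((false ∷ true ∷ true ∷ false ∷ []) ^⟨ 4 * c ∸ 2 ⟩) c
    × IsMLCS ((true ∷ false ∷ []) ^⟨ 4 * c ∸ 2 ⟩) ((false ∷ true ∷ true ∷ false ∷ []) ^⟨ 4 * c ∸ 2 ⟩) ((2 * c) C c)
propositionA1 (suc c) _ =
  subst₂ (λ u v → IsDist u v (suc c) × IsMLCS u v ((2 * suc c) C suc c)) (sym u≡x) (sym v≡y)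
    (subst (λ n → IsDist x y (suc c) × IsMLCS x y (n C suc c)) 2+c+c≡2*[1+c]
      (dist-mlcs-family (λ ()) (c + c) (suc c) (s≤s (≤-trans (m≤m+n c c) (n≤1+n (c + c))))))
  where
  N : ℕ
  N = 4 * suc c ∸ 2
  x y : Word
  x = alternating true false (suc c + suc c + (c + c))
  y = paired false true false (2 + ((c + c) + (c + c)))
  2+c+c≡2*[1+c] : 2 + (c + c) ≡ 2 * suc c
  2+c+c≡2*[1+c] = solve (c ∷ [])
  4[1+c]≡2+|x| : 4 * suc c ≡ 2 + (suc c + suc c + (c + c))
  4[1+c]≡2+|x| = solve (c ∷ [])
  4[1+c]≡2+|y| : 4 * suc c ≡ 2 + (2 + ((c + c) + (c + c)))
  4[1+c]≡2+|y| = solve (c ∷ [])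
  u≡x : (true ∷ false ∷ []) ^⟨ N ⟩ ≡ x
  u≡x = trans (take-cycle-alternating true false N N ≤-refl)
              (cong (λ n → alternating true false (n ∸ 2)) 4[1+c]≡2+|x|)
  v≡y : (false ∷ true ∷ true ∷ false ∷ []) ^⟨ N ⟩ ≡ y
  v≡y = trans (take-cycle-paired false true N N ≤-refl)
              (cong (λ n → paired false true false (n ∸ 2)) 4[1+c]≡2+|y|)
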